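{- (1-cut) For every sequent $\Gamma$ and formula $A$ of LMRL, if $\vdash\Gamma,\emptyset\{A\}$ is derivable in LMRL, then $\vdash\Gamma$ is derivable in LMRL.
   Context: Fix a set $\Omega$ of roles (possibly infinite). A role set is a subset $R\subseteq\Omega$; $\overline{R}=\Omega\setminus R$; $R_1\uplus\cdots\uplus R_n=\Omega$ means the $R_i$ are pairwise disjoint with union $\Omega$. An ultrafilter on $\Omega$ is a family $\mathcal U$ of subsets of $\Omega$ with $\Omega\in\mathcal U$, closed upward and under binary intersection, and containing $R$ or $\overline R$ for every $R$. For an endomorphism $f$ of $\Omega$, $f^{ -1}(R)=\{r\mid f(r)\in R\}$. Formulas of LMRL, over first-order terms $t$ and variables $x$: $A,B::=a\mid\neg_f(A)\mid A\otimes_{\mathcal U}B\mid A\,\&_{\mathcal U}B\mid !_{\mathcal U}(A)\mid\forall_{\mathcal U}(\lambda x.A)$ ($a$ primitive, $f$ endomorphisms, $\mathcal U$ ultrafilters); $A[x:=t]$ is substitution. An i-formula is $R\{A\}$; a sequent is a finite multiset of i-formulas. $?(\Gamma)$ denotes a sequent every i-formula of which has the form $R\{!_{\mathcal U}(C)\}$ with $R\notin\mathcal U$. Rules of LMRL: (Id) $\vdash R_1\{a\},\ldots,R_n\{a\}$ whenever $R_1\uplus\cdots\uplus R_n=\Omega$; ($\neg$) from $\Gamma,f^{ -1}(R)\{A\}$ infer $\Gamma,R\{\neg_f(A)\}$; ($\&$-neg-l/r) if $R\notin\mathcal U$, from $\Gamma,R\{A\}$ (resp. $\Gamma,R\{B\}$)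 infer $\Gamma,R\{A\,\&_{\mathcal U}B\}$; ($\&$-pos) if $R\in\mathcal U$, from $\Gamma,R\{A\}$ and $\Gamma,R\{B\}$ infer $\Gamma,R\{A\,\&_{\mathcal U}B\}$; ($\otimes$-neg) if $R\notin\mathcal U$, from $\Gamma,R\{A\},R\{B\}$ infer $\Gamma,R\{A\otimes_{\mathcal U}B\}$; ($\otimes$-pos) if $R\in\mathcal U$, from $\Gamma_1,R\{A\}$ and $\Gamma_2,R\{B\}$ infer $\Gamma_1,\Gamma_2,R\{A\otimes_{\mathcal U}B\}$; ($!$-pos) if $R\in\mathcal U$, from $?(\Gamma),R\{A\}$ infer $?(\Gamma),R\{!_{\mathcal U}(A)\}$; ($!$-neg-weaken) if $R\notin\mathcal U$, from $\Gamma$ infer $\Gamma,R\{!_{\mathcal U}(A)\}$; ($!$-neg-derelict) if $R\notin\mathcal U$, from $\Gamma,R\{A\}$ infer $\Gamma,R\{!_{\mathcal U}(A)\}$; ($!$-neg-contract) if $R\notin\mathcal U$, from $\Gamma,R\{!_{\mathcal U}(A)\},R\{!_{\mathcal U}(A)\}$ infer $\Gamma,R\{!_{\mathcal U}(A)\}$; ($\forall$-neg) if $R\notin\mathcal U$, from $\Gamma,R\{A[x:=t]\}$ infer $\Gamma,R\{\forall_{\mathcal U}(\lambda x.A)\}$; ($\forall$-pos) if $R\in\mathcal U$ and $x$ not free in $\Gamma$, from $\Gamma,R\{A\}$ infer $\Gamma,R\{\forall_{\mathcal U}(\lambda x.A)\}$. -}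

module Defs where

open import Data.Nat using (ℕ; suc)
open import Data.Fin using (Fin; zero; suc)
open import Data.Vec using (Vec; []; _∷_)
open import Data.List using (List; []; _∷_; _++_; map; tabulate)
open import Data.List.Relation.Unary.All using (All)
open import Data.List.Relation.Binary.Permutation.Propositional using (_↭_)
open import Data.Product using (Σ; _×_)
open import Data.Sum using (_⊎_)
open import Data.Empty using (⊥)
open import Data.Unit using (⊤)
open import Relation.Nullary using (¬_)
open import Relation.Binary.PropositionalEquality using (_≡_)

record Signature : Set₁ where
  field
    Fun    : Set
    fArity : Fun → ℕ
    Rel    : Set
    rArity : Rel → ℕ

module LMRL (Ω : Set) (S : Signature) where
  open Signature S

  RoleSet : Set₁
  RoleSet = Ω → Set

  ∅ : RoleSet
  ∅ _ = ⊥

  whole : RoleSet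
  whole _ = ⊤

  ∁ : RoleSet → RoleSet
  ∁ R r = ¬ R r

  _∩_ : RoleSet → RoleSet → RoleSet
  (R ∩ R') r = R r × R' r

  _⊆_ : RoleSet → RoleSet → Set
  R ⊆ R' = ∀ r → R r → R' r

  preimage : (Ω → Ω) → RoleSet → RoleSet
  preimage f R r = R (f r)

  record Ultrafilter : Set₁ where
    field
      _∋_      : RoleSet → Set
      ∋whole   : _∋_ whole
      upward   : ∀ {R R'} → R ⊆ R' → _∋_ R → _∋_ R'
      ∋∩       : ∀ {R R'} → _∋_ R → _∋_ R' → _∋_ (R ∩ R')
      ultra    : ∀ R → _∋_ R ⊎ _∋_ (∁ R)
      proper   : ¬ (_∋_ ∅)
  open Ultrafilter public using (_∋_)

  Partition : ∀ {k} → (Fin k → RoleSet) → Set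
  Partition {k} Rs =
    (∀ r → Σ (Fin k) λ i → Rs i r) ×
    (∀ i j r → Rs i r → Rs j r → i ≡ j)

  data Term (n : ℕ) : Set where
    var : Fin n → Term n
    fun : (g : Fun) → Vec (Term n) (fArity g) → Term n

  mutual
    renT : ∀ {n m} → (Fin n → Fin m) → Term n → Term m
    renT ρ (var i)    = var (ρ i)
    renT ρ (fun g ts) = fun g (renTs ρ ts)

    renTs : ∀ {n m k} → (Fin n → Fin m) → Vec (Term n) k → Vec (Term m) k
    renTs ρ []       = []
    renTs ρ (t ∷ ts) = renT ρ t ∷ renTs ρ ts

  mutual
    subT : ∀ {n m} → (Fin n → Term m) → Term n → Term m
    subT σ (var i)    = σ i
    subT σ (fun g ts) = fun g (subTs σ ts)

    subTs : ∀ {n m k} → (Fin n → Term m) → Vec (Term n) k → Vec (Term m) k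
    subTs σ []       = []
    subTs σ (t ∷ ts) = subT σ t ∷ subTs σ ts

  lift : ∀ {n m} → (Fin n → Term m) → Fin (suc n) → Term (suc m)
  lift σ zero    = var zero
  lift σ (suc i) = renT suc (σ i)

  -- formulas of LMRL; ∀ binds de Bruijn variable 0
  data Formula (n : ℕ) : Set₁ where
    atom   : (P : Rel) → Vec (Term n) (rArity P) → Formula n
    neg    : (Ω → Ω) → Formula n → Formula n
    tensor : Ultrafilter → Formula n → Formula n → Formula n
    with'  : Ultrafilter → Formula n → Formula n → Formula n
    bang   : Ultrafilter → Formula n → Formula n
    all    : Ultrafilter → Formula (suc n) → Formula n

  subF : ∀ {n m} → (Fin n → Term m) → Formula n → Formula m
  subF σ (atom P ts)    = atom P (subTs σ ts)
  subF σ (neg f A)      = neg f (subF σ A)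
  subF σ (tensor U A B) = tensor U (subF σ A) (subF σ B)
  subF σ (with' U A B)  = with' U (subF σ A) (subF σ B)
  subF σ (bang U A)     = bang U (subF σ A)
  subF σ (all U A)      = all U (subF (lift σ) A)

  _[_] : ∀ {n} → Formula (suc n) → Term n → Formula n
  A [ t ] = subF (λ { zero → t ; (suc i) → var i }) A

  record IFormula (n : ℕ) : Set₁ where
    constructor _⟪_⟫
    field
      role : RoleSet
      form : Formula n

  weakenI : ∀ {n} → IFormula n → IFormula (suc n)
  weakenI (R ⟪ A ⟫) = R ⟪ subF (λ i → var (suc i)) A ⟫

  -- sequents: finite multisets, represented by lists up to permutation (rule exch)
  Sequent : ℕ → Set₁
  Sequent n = List (IFormula n)

  data WhyNot {n} : IFormula n → Set₁ where
    wn : ∀ {R U C} → ¬ (U ∋ R) → WhyNot (R ⟪ bang U C ⟫)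

  infix 4 ⊢_
  data ⊢_ : ∀ {n} → Sequent n → Set₁ where
    exch : ∀ {n} {Γ Δ : Sequent n} → Γ ↭ Δ → ⊢ Γ → ⊢ Δ
    ax   : ∀ {n k} (Rs : Fin k → RoleSet) (P : Rel) (ts : Vec (Term n) (rArity P)) →
           Partition Rs → ⊢ tabulate (λ i → Rs i ⟪ atom P ts ⟫)
    neg-r : ∀ {n} {Γ : Sequent n} {R f A} →
           ⊢ preimage f R ⟪ A ⟫ ∷ Γ → ⊢ R ⟪ neg f A ⟫ ∷ Γ
    with-neg-l : ∀ {n} {Γ : Sequent n} {R U A B} → ¬ (U ∋ R) →
           ⊢ R ⟪ A ⟫ ∷ Γ → ⊢ R ⟪ with' U A B ⟫ ∷ Γ
    with-neg-r : ∀ {n} {Γ : Sequent n} {R U A B} → ¬ (U ∋ R) →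
           ⊢ R ⟪ B ⟫ ∷ Γ → ⊢ R ⟪ with' U A B ⟫ ∷ Γ
    with-pos : ∀ {n} {Γ : Sequent n} {R U A B} → U ∋ R →
           ⊢ R ⟪ A ⟫ ∷ Γ → ⊢ R ⟪ B ⟫ ∷ Γ → ⊢ R ⟪ with' U A B ⟫ ∷ Γ
    tensor-neg : ∀ {n} {Γ : Sequent n} {R U A B} → ¬ (U ∋ R) →
           ⊢ R ⟪ A ⟫ ∷ R ⟪ B ⟫ ∷ Γ → ⊢ R ⟪ tensor U A B ⟫ ∷ Γ
    tensor-pos : ∀ {n} {Γ₁ Γ₂ : Sequent n} {R U A B} → U ∋ R →
           ⊢ R ⟪ A ⟫ ∷ Γ₁ → ⊢ R ⟪ B ⟫ ∷ Γ₂ → ⊢ R ⟪ tensor U A B ⟫ ∷ Γ₁ ++ Γ₂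
    bang-pos : ∀ {n} {Γ : Sequent n} {R U A} → All WhyNot Γ → U ∋ R →
           ⊢ R ⟪ A ⟫ ∷ Γ → ⊢ R ⟪ bang U A ⟫ ∷ Γ
    bang-weaken : ∀ {n} {Γ : Sequent n} {R U A} → ¬ (U ∋ R) →
           ⊢ Γ → ⊢ R ⟪ bang U A ⟫ ∷ Γ
    bang-derelict : ∀ {n} {Γ : Sequent n} {R U A} → ¬ (U ∋ R) →
           ⊢ R ⟪ A ⟫ ∷ Γ → ⊢ R ⟪ bang U A ⟫ ∷ Γ
    bang-contract : ∀ {n} {Γ : Sequent n} {R U A} → ¬ (U ∋ R) →
           ⊢ R ⟪ bang U A ⟫ ∷ R ⟪ bang U A ⟫ ∷ Γ → ⊢ R ⟪ bang U A ⟫ ∷ Γ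
    all-neg : ∀ {n} {Γ : Sequent n} {R U A} → ¬ (U ∋ R) → (t : Term n) →
           ⊢ R ⟪ A [ t ] ⟫ ∷ Γ → ⊢ R ⟪ all U A ⟫ ∷ Γ
    all-pos : ∀ {n} {Γ : Sequent n} {R U A} → U ∋ R →
           ⊢ R ⟪ A ⟫ ∷ map weakenI Γ → ⊢ R ⟪ all U A ⟫ ∷ Γ

{-# OPTIONS --safe #-}
-- An i-formula whose role set is empty is inert.  No positive rule can introduce it,
-- since an ultrafilter never contains ∅; every negative rule only produces i-formulas
-- with the same role set or its preimage, which is again empty; and an empty block of
-- a partition may be dropped from an axiom.  Hence all i-formulas with empty role set
-- can be erased from a derivation at once, by induction on the derivation.  Erasing
-- them simultaneously, rather than one at a time, is what lets contraction and ⊗-neg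
-- (which duplicate the erased i-formula) go through.
module Submission where

open import Level using (_⊔_)
open import Function using (_∘_)
open import Data.Nat using (zero; suc)
open import Data.Fin using (Fin; zero; suc; punchIn; punchOut; _≟_)
open import Data.Fin.Properties using (punchIn-injective; punchIn-punchOut)
open import Data.List using (List; []; _∷_; _++_; map; tabulate)
open import Data.Vec using (Vec)
open import Data.List.Relation.Unary.All using (All; []; _∷_)
open import Data.List.Relation.Binary.Permutation.Propositional
  using (_↭_; refl; prep; swap; trans; ↭-refl; ↭-trans)
open import Data.Product using (Σ; ∃; ∃₂; _×_; _,_)
open import Data.Sum using (_⊎_; inj₁; inj₂)
open import Data.Empty using (⊥-elim)
open import Relation.Nullary using (¬_; yes; no)
open import Relation.Unary using (Pred)
open import Relation.Binary.PropositionalEquality using (_≡_; refl; subst; sym)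

open import Defs

module _ {a p} {A : Set a} (P : Pred A p) where

  data Dropping : List A → List A → Set (a ⊔ p) where
    []   : Dropping [] []
    drop : ∀ {x xs ys} → P x → Dropping xs ys → Dropping (x ∷ xs) ys
    keep : ∀ {x xs ys} → Dropping xs ys → Dropping (x ∷ xs) (x ∷ ys)

module _ {a p} {A : Set a} {P : Pred A p} where

  Dropping-refl : ∀ xs → Dropping P xs xs
  Dropping-refl []       = []
  Dropping-refl (x ∷ xs) = keep (Dropping-refl xs)

  Dropping-All : ∀ {q} {Q : Pred A q} {xs ys} → All Q xs → Dropping P xs ys → All Q ys
  Dropping-All []         []         = []
  Dropping-All (_ ∷ qxs)  (drop _ d) = Dropping-All qxs d
  Dropping-All (qx ∷ qxs) (keep d)   = qx ∷ Dropping-All qxs d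

  Dropping-map : ∀ {b q} {B : Set b} {Q : Pred B q} (f : A → B) → (∀ {x} → P x → Q (f x)) →
                 ∀ {xs ys} → Dropping P xs ys → Dropping Q (map f xs) (map f ys)
  Dropping-map f pf []          = []
  Dropping-map f pf (drop px d) = drop (pf px) (Dropping-map f pf d)
  Dropping-map f pf (keep d)    = keep (Dropping-map f pf d)

  Dropping-++⁻ : ∀ xs {ys zs} → Dropping P (xs ++ ys) zs →
                 ∃₂ λ xs′ ys′ → Dropping P xs xs′ × Dropping P ys ys′ × zs ≡ xs′ ++ ys′
  Dropping-++⁻ []       d = [] , _ , [] , d , refl
  Dropping-++⁻ (x ∷ xs) (drop px d) with Dropping-++⁻ xs d
  ... | xs′ , ys′ , d₁ , d₂ , refl = xs′ , ys′ , drop px d₁ , d₂ , refl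
  Dropping-++⁻ (x ∷ xs) (keep d) with Dropping-++⁻ xs d
  ... | xs′ , ys′ , d₁ , d₂ , refl = x ∷ xs′ , ys′ , keep d₁ , d₂ , refl

  Dropping-resp-↭ : ∀ {xs ys ys′} → xs ↭ ys → Dropping P ys ys′ →
                    ∃ λ xs′ → Dropping P xs xs′ × xs′ ↭ ys′
  Dropping-resp-↭ refl d = _ , d , ↭-refl
  Dropping-resp-↭ (prep x π) (drop px d) with Dropping-resp-↭ π d
  ... | xs′ , d′ , π′ = xs′ , drop px d′ , π′
  Dropping-resp-↭ (prep x π) (keep d) with Dropping-resp-↭ π d
  ... | xs′ , d′ , π′ = x ∷ xs′ , keep d′ , prep x π′
  Dropping-resp-↭ (swap x y π) (drop py (drop px d)) with Dropping-resp-↭ π d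
  ... | xs′ , d′ , π′ = xs′ , drop px (drop py d′) , π′
  Dropping-resp-↭ (swap x y π) (drop py (keep d)) with Dropping-resp-↭ π d
  ... | xs′ , d′ , π′ = x ∷ xs′ , keep (drop py d′) , prep x π′
  Dropping-resp-↭ (swap x y π) (keep (drop px d)) with Dropping-resp-↭ π d
  ... | xs′ , d′ , π′ = y ∷ xs′ , drop px (keep d′) , prep y π′
  Dropping-resp-↭ (swap x y π) (keep (keep d)) with Dropping-resp-↭ π d
  ... | xs′ , d′ , π′ = x ∷ y ∷ xs′ , keep (keep d′) , swap x y π′
  Dropping-resp-↭ (trans π₁ π₂) d with Dropping-resp-↭ π₂ d
  ... | _ , d₂ , π₂′ with Dropping-resp-↭ π₁ d₂
  ... | xs′ , d₁ , π₁′ = xs′ , d₁ , ↭-trans π₁′ π₂′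

  Dropping-tabulate : ∀ {k} (f : Fin (suc k) → A) {ys} → Dropping P (tabulate f) ys →
                      ys ≡ tabulate f ⊎ ∃ λ i → P (f i) × Dropping P (tabulate (f ∘ punchIn i)) ys
  Dropping-tabulate f (drop px d)       = inj₂ (zero , px , d)
  Dropping-tabulate {zero}  f (keep []) = inj₁ refl
  Dropping-tabulate {suc k} f (keep d) with Dropping-tabulate (f ∘ suc) d
  ... | inj₁ refl          = inj₁ refl
  ... | inj₂ (i , px , d′) = inj₂ (suc i , px , keep d′)

module _ (Ω : Set) (S : Signature) where
  open LMRL Ω S

  EmptyRole : ∀ {n} → IFormula n → Set
  EmptyRole x = IFormula.role x ⊆ ∅

  ∌-⊆∅ : ∀ U {R} → R ⊆ ∅ → ¬ (U ∋ R)
  ∌-⊆∅ U R⊆∅ U∋R = Ultrafilter.proper U (Ultrafilter.upward U R⊆∅ U∋R)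

  Partition-punchIn : ∀ {k} {Rs : Fin (suc k) → RoleSet} i → Rs i ⊆ ∅ → Partition Rs →
                      Partition (Rs ∘ punchIn i)
  Partition-punchIn {Rs = Rs} i Rsᵢ⊆∅ (cover , disjoint) =
    cover′ , λ j j′ r p p′ → punchIn-injective i j j′ (disjoint _ _ r p p′)
    where
    cover′ : ∀ r → Σ (Fin _) λ j → Rs (punchIn i j) r
    cover′ r with cover r
    ... | j , p with i ≟ j
    ... | yes refl = ⊥-elim (Rsᵢ⊆∅ r p)
    ... | no i≢j   = punchOut i≢j , subst (λ j′ → Rs j′ r) (sym (punchIn-punchOut i≢j)) p

  ax-dropping : ∀ {n k} (Rs : Fin k → RoleSet) P (ts : Vec (Term n) _) {Δ} → Partition Rs →
                Dropping EmptyRole (tabulate (λ i → Rs i ⟪ atom P ts ⟫)) Δ → ⊢ Δ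
  ax-dropping {k = zero} Rs P ts part [] = ax Rs P ts part
  ax-dropping {k = suc k} Rs P ts part d with Dropping-tabulate (λ i → Rs i ⟪ atom P ts ⟫) d
  ... | inj₁ refl          = ax Rs P ts part
  ... | inj₂ (i , e , d′)  = ax-dropping (Rs ∘ punchIn i) P ts (Partition-punchIn i e part) d′

  ⊢-dropping : ∀ {n} {Γ Δ : Sequent n} → ⊢ Γ → Dropping EmptyRole Γ Δ → ⊢ Δ
  ⊢-dropping (exch π d) δ with Dropping-resp-↭ π δ
  ... | _ , δ′ , π′ = exch π′ (⊢-dropping d δ′)
  ⊢-dropping (ax Rs P ts part) δ = ax-dropping Rs P ts part δ
  ⊢-dropping (neg-r {f = f} d) (drop e δ) = ⊢-dropping d (drop (e ∘ f) δ)
  ⊢-dropping (neg-r d)         (keep δ)   = neg-r (⊢-dropping d (keep δ))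
  ⊢-dropping (with-neg-l u d) (drop e δ) = ⊢-dropping d (drop e δ)
  ⊢-dropping (with-neg-l u d) (keep δ)   = with-neg-l u (⊢-dropping d (keep δ))
  ⊢-dropping (with-neg-r u d) (drop e δ) = ⊢-dropping d (drop e δ)
  ⊢-dropping (with-neg-r u d) (keep δ)   = with-neg-r u (⊢-dropping d (keep δ))
  ⊢-dropping (with-pos {U = U} u d d′) (drop e δ) = ⊥-elim (∌-⊆∅ U e u)
  ⊢-dropping (with-pos u d d′) (keep δ) = with-pos u (⊢-dropping d (keep δ)) (⊢-dropping d′ (keep δ))
  ⊢-dropping (tensor-neg u d) (drop e δ) = ⊢-dropping d (drop e (drop e δ))
  ⊢-dropping (tensor-neg u d) (keep δ)   = tensor-neg u (⊢-dropping d (keep (keep δ)))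
  ⊢-dropping (tensor-pos {U = U} u d d′) (drop e δ) = ⊥-elim (∌-⊆∅ U e u)
  ⊢-dropping (tensor-pos {Γ₁ = Γ₁} u d d′) (keep δ) with Dropping-++⁻ Γ₁ δ
  ... | _ , _ , δ₁ , δ₂ , refl = tensor-pos u (⊢-dropping d (keep δ₁)) (⊢-dropping d′ (keep δ₂))
  ⊢-dropping (bang-pos {U = U} w u d) (drop e δ) = ⊥-elim (∌-⊆∅ U e u)
  ⊢-dropping (bang-pos w u d) (keep δ) = bang-pos (Dropping-All w δ) u (⊢-dropping d (keep δ))
  ⊢-dropping (bang-weaken u d) (drop e δ) = ⊢-dropping d δ
  ⊢-dropping (bang-weaken u d) (keep δ)   = bang-weaken u (⊢-dropping d δ)
  ⊢-dropping (bang-derelict u d) (drop e δ) = ⊢-dropping d (drop e δ)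
  ⊢-dropping (bang-derelict u d) (keep δ)   = bang-derelict u (⊢-dropping d (keep δ))
  ⊢-dropping (bang-contract u d) (drop e δ) = ⊢-dropping d (drop e (drop e δ))
  ⊢-dropping (bang-contract u d) (keep δ)   = bang-contract u (⊢-dropping d (keep (keep δ)))
  ⊢-dropping (all-neg u t d) (drop e δ) = ⊢-dropping d (drop e δ)
  ⊢-dropping (all-neg u t d) (keep δ)   = all-neg u t (⊢-dropping d (keep δ))
  ⊢-dropping (all-pos {U = U} u d) (drop e δ) = ⊥-elim (∌-⊆∅ U e u)
  ⊢-dropping (all-pos u d) (keep δ) = all-pos u (⊢-dropping d (keep (Dropping-map weakenI (λ e → e) δ)))

lemma11 : (Ω : Set) (S : Signature) →
    let open LMRL Ω S in
      ∀ {n} (Γ : Sequent n) (A : Formula n) → ⊢ ∅ ⟪ A ⟫ ∷ Γ → ⊢ Γ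
lemma11 Ω S Γ A d = ⊢-dropping Ω S d (drop (λ _ ()) (Dropping-refl Γ))
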